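{- The sum $L$ of a modular connected system is locally finite.
   Context: A lattice is l.f.f.c. if every closed interval is finite and every element has finitely many upper covers and finitely many lower covers. $x\lessdot y$ means $y$ covers $x$. A tolerance on a lattice $S$ is a reflexive, symmetric relation $\gamma$ with $a\,\gamma\,b$, $c\,\gamma\,d$ implying $(a\vee c)\,\gamma\,(b\vee d)$ and $(a\wedge c)\,\gamma\,(b\wedge d)$; $x\le_\gamma y$ means $x\le y$ and $x\,\gamma\,y$. A modular connected system $(S,\gamma,(L_x)_{x\in S},(\varphi_x^y)_{x\le_\gamma y})$ is a lattice $S$, a tolerance $\gamma$ on $S$, lattices $L_x$ and maps $\varphi_x^y$ satisfying: (MC1) $S$ is l.f.f.c.; (MC2) each $L_x$ is finite, modular, complemented; (MC3) each $\varphi_x^y$ is a lattice isomorphism from a nonempty lattice filter $F_x^y$ of $L_x$ onto a lattice ideal $I_x^y$ of $L_y$; (MC4) $F_x^x=I_x^x=L_x$, $\varphi_x^x=\mathrm{id}$; (MC5) if $x\le_\gamma y\le_\gamma z$ and $I_x^y\cap F_y^z\neq\emptyset$ then $x\,\gamma\,z$; (MC6) for $x\le z\le y$ with $x\,\gamma\,y$: $F_x^y=(\varphi_x^z)^{ -1}(I_x^z\cap F_z^y)$, $I_x^y=\varphi_z^y(I_x^z\cap F_z^y)$, $\varphi_x^y=\varphi_z^y\circ\varphi_x^z|_{F_x^y}$; (MC7) if $x\,\gamma\,y$ then $I_x^{x\vee y}\cap I_y^{x\vee y}\subseteq I_{x\wedge y}^{x\vee y}$ and $F_{x\wedge y}^x\cap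 F_{x\wedge y}^y\subseteq F_{x\wedge y}^{x\vee y}$; (MC8.1) $x\lessdot y$ implies $x\,\gamma\,y$; (MC8.2) $x\lessdot y$ implies $F_x^y\neq L_x$ and $I_x^y\neq L_y$. Sum: $M=\{(x,a):x\in S,a\in L_x\}$, $(x,a)\sim(y,b)$ iff $x\,\gamma\,y$, $a\in F_x^{x\vee y}$, $b\in F_y^{x\vee y}$, $\varphi_x^{x\vee y}(a)=\varphi_y^{x\vee y}(b)$ (an equivalence relation); $L=M/{\sim}$; $\pi_x(a)$ is the class of $(x,a)$, $\Lambda_x=\pi_x(L_x)$. For $v\in S$, $a\le_v b$ iff $a,b\in\Lambda_v$ and $\pi_v^{ -1}a\le\pi_v^{ -1}b$ in $L_v$. $L$ is partially ordered by $a\le b$ iff there exist $n\ge0$, $x_1\le\dots\le x_n$ in $S$ and $a=a_0\le_{x_1}a_1\le_{x_2}\cdots\le_{x_n}a_n=b$. Locally finite means every interval $[a,b]$ of $L$ is finite. -}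

module Defs where

open import Data.Product using (Σ; Σ-syntax; ∃; ∃-syntax; _×_; _,_)
open import Data.Sum using (_⊎_)
open import Data.List using (List)
open import Data.List.Membership.Propositional using (_∈_)
open import Data.List.Relation.Unary.Any using (Any)
open import Relation.Binary.Core using (Rel)
open import Relation.Binary.PropositionalEquality using (_≡_)
open import Relation.Binary.Lattice.Structures using (IsLattice)
open import Relation.Nullary using (¬_)
open import Function.Bundles using (_⇔_)

record Lat : Set₁ where
  infix 4 _≤_
  infixr 6 _∨_
  infixr 7 _∧_
  field
    Carrier   : Set
    _≤_       : Rel Carrier _
    _∨_       : Carrier → Carrier → Carrier
    _∧_       : Carrier → Carrier → Carrier
    isLattice : IsLattice _≡_ _≤_ _∨_ _∧_

open Lat public using (Carrier)

module _ (L : Lat) where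
  open Lat L hiding (Carrier)

  _⋖_ : Carrier L → Carrier L → Set
  x ⋖ y = x ≤ y × ¬ (x ≡ y) × (∀ z → x ≤ z → z ≤ y → z ≡ x ⊎ z ≡ y)

  LFFC : Set
  LFFC = (∀ x y → ∃[ zs ] (∀ z → x ≤ z → z ≤ y → z ∈ zs))
       × (∀ x → ∃[ zs ] (∀ y → x ⋖ y → y ∈ zs))
       × (∀ y → ∃[ zs ] (∀ x → x ⋖ y → x ∈ zs))

  Finite : Set
  Finite = ∃[ xs ] (∀ (x : Carrier L) → x ∈ xs)

  Modular : Set
  Modular = ∀ a b c → a ≤ c → a ∨ (b ∧ c) ≡ (a ∨ b) ∧ c

  Complemented : Set
  Complemented = Σ[ ⊥ ∈ Carrier L ] Σ[ ⊤ ∈ Carrier L ]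
      (∀ a → ⊥ ≤ a) × (∀ a → a ≤ ⊤) ×
      (∀ a → ∃[ b ] (a ∨ b ≡ ⊤ × a ∧ b ≡ ⊥))

  IsFilter : (Carrier L → Set) → Set
  IsFilter F = (∀ a b → F a → a ≤ b → F b) × (∀ a b → F a → F b → F (a ∧ b))

  IsIdeal : (Carrier L → Set) → Set
  IsIdeal I = (∀ a b → I b → a ≤ b → I a) × (∀ a b → I a → I b → I (a ∨ b))

IsLatIsoOnto : (L K : Lat) → (Carrier L → Set) → (Carrier K → Set)
             → (Carrier L → Carrier K) → Set
IsLatIsoOnto L K F I φ =
    (∀ a → F a → I (φ a))
  × (∀ a b → F a → F b → φ a ≡ φ b → a ≡ b)
  × (∀ b → I b → ∃[ a ] (F a × φ a ≡ b))
  × (∀ a b → F a → F b → φ (Lat._∨_ L a b) ≡ Lat._∨_ K (φ a) (φ b))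
  × (∀ a b → F a → F b → φ (Lat._∧_ L a b) ≡ Lat._∧_ K (φ a) (φ b))

record MCSystem : Set₁ where
  field
    S  : Lat
  open Lat S public hiding (Carrier) renaming (_≤_ to _≤S_; _∨_ to _∨S_; _∧_ to _∧S_)
  field
    γ        : Carrier S → Carrier S → Set
    γ-refl   : ∀ x → γ x x
    γ-sym    : ∀ x y → γ x y → γ y x
    γ-∨      : ∀ a b c d → γ a b → γ c d → γ (a ∨S c) (b ∨S d)
    γ-∧      : ∀ a b c d → γ a b → γ c d → γ (a ∧S c) (b ∧S d)
    L  : Carrier S → Lat
    -- F_x^y, I_x^y, φ_x^y; only meaningful (and only constrained) when x ≤_γ y
    F  : (x y : Carrier S) → Carrier (L x) → Set
    I  : (x y : Carrier S) → Carrier (L y) → Set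
    φ  : (x y : Carrier S) → Carrier (L x) → Carrier (L y)

  _≤γ_ : Carrier S → Carrier S → Set
  x ≤γ y = x ≤S y × γ x y

  field
    MC1   : LFFC S
    MC2   : ∀ x → Finite (L x) × Modular (L x) × Complemented (L x)
    MC3   : ∀ x y → x ≤γ y →
              IsFilter (L x) (F x y) × (∃[ a ] F x y a)
            × IsIdeal (L y) (I x y)
            × IsLatIsoOnto (L x) (L y) (F x y) (I x y) (φ x y)
    MC4   : ∀ x → (∀ a → F x x a) × (∀ a → I x x a) × (∀ a → φ x x a ≡ a)
    MC5   : ∀ x y z → x ≤γ y → y ≤γ z → (∃[ a ] (I x y a × F y z a)) → γ x z
    MC6   : ∀ x z y → x ≤S z → z ≤S y → γ x y →
              (∀ a → F x y a ⇔ (F x z a × I x z (φ x z a) × F z y (φ x z a)))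
            × (∀ b → I x y b ⇔ (∃[ c ] (I x z c × F z y c × φ z y c ≡ b)))
            × (∀ a → F x y a → φ x y a ≡ φ z y (φ x z a))
    MC7   : ∀ x y → γ x y →
              (∀ a → I x (x ∨S y) a → I y (x ∨S y) a → I (x ∧S y) (x ∨S y) a)
            × (∀ a → F (x ∧S y) x a → F (x ∧S y) y a → F (x ∧S y) (x ∨S y) a)
    MC8-1 : ∀ x y → _⋖_ S x y → γ x y
    MC8-2 : ∀ x y → _⋖_ S x y → ¬ (∀ a → F x y a) × ¬ (∀ b → I x y b)

  -- The sum L = M/∼, represented by M together with the relation ∼

  M : Set
  M = Σ[ x ∈ Carrier S ] Carrier (L x)

  _∼_ : M → M → Set
  (x , a) ∼ (y , b) = γ x y × F x (x ∨S y) a × F y (x ∨S y) b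
                    × φ x (x ∨S y) a ≡ φ y (x ∨S y) b

  -- a ≤_v b  (on representatives: both classes lie in Λ_v and the
  -- corresponding elements of L_v are ordered)
  _≤[_]_ : M → Carrier S → M → Set
  m ≤[ v ] n = ∃[ p ] ∃[ q ] ((v , p) ∼ m × (v , q) ∼ n × Lat._≤_ (L v) p q)

  -- chains a = a₀ ≤_{x₁} a₁ ≤_{x₂} ⋯ ≤_{xₙ} aₙ = b with x₁ ≤ ⋯ ≤ xₙ, n ≥ 1,
  -- whose first index is v
  data ChainFrom : Carrier S → M → M → Set where
    one  : ∀ {v m n} → m ≤[ v ] n → ChainFrom v m n
    more : ∀ {v w m k n} → v ≤S w → m ≤[ v ] k → ChainFrom w k n → ChainFrom v m n

  -- order on L (n = 0 means a = b, i.e. the representatives are ∼-equivalent)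
  _≤L_ : M → M → Set
  m ≤L n = m ∼ n ⊎ ∃[ v ] ChainFrom v m n

  LocallyFinite : Set
  LocallyFinite = ∀ a b → ∃[ cs ] (∀ c → a ≤L c → c ≤L b → Any (c ∼_) cs)

{-# OPTIONS --safe #-}
-- An element c of the interval [(x , a) , (y , b)] has a representative over some w ≥ x
-- (walking up the defining chain from (x , a): filters are upward closed) and one over
-- some u ≤ y (walking down from (y , b): ideals are downward closed, and an element
-- of L_v equivalent to one over u lies in the ideal I_{v∧u}^v by MC7).  The two
-- representatives are equivalent, so c is represented over w ∧ u, hence over every
-- index between w ∧ u and w, in particular over t = (w ∧ u) ∨ (x ∧ y) ∈ [x ∧ y , y].
-- That interval of S and every L_t are finite.  Monotonicity of the indices of a chain
-- is never used.  Transitivity of ∼ goes through identification at a common upper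
-- index: MC6 moves it down, MC5 and MC6 move it up, and MC7 glues two of them.
module Submission where

open import Level using (0ℓ)
open import Data.Product using (Σ-syntax; ∃-syntax; _×_; _,_; proj₁; proj₂)
open import Data.Sum using (inj₁; inj₂)
open import Data.List using (List; concatMap; map)
open import Data.List.Membership.Propositional using (_∈_; lose)
open import Data.List.Membership.Propositional.Properties using (∈-map⁺; ∈-concatMap⁺)
open import Data.List.Relation.Unary.Any using (Any)
open import Function.Base using (_∘_)
open import Function.Bundles using (Equivalence)
open import Relation.Binary.Core using (Rel)
open import Relation.Binary.Lattice using (Lattice; IsLattice)
import Relation.Binary.Lattice.Properties.JoinSemilattice as JoinSemilatticeProperties
import Relation.Binary.Lattice.Properties.MeetSemilattice as MeetSemilatticeProperties
open import Relation.Binary.PropositionalEquality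
  using (_≡_; refl; sym; trans; cong; subst; subst₂; module ≡-Reasoning)
open import Defs

module _ {A : Set} {B : A → Set} where

  dependentPairs : List A → ((a : A) → List (B a)) → List (Σ[ a ∈ A ] B a)
  dependentPairs as bs = concatMap (λ a → map (a ,_) (bs a)) as

  ∈-dependentPairs : ∀ {as bs a b} → a ∈ as → b ∈ bs a → (a , b) ∈ dependentPairs as bs
  ∈-dependentPairs {bs = bs} {a} a∈as b∈bs =
    ∈-concatMap⁺ (λ a → map (a ,_) (bs a)) (lose a∈as (∈-map⁺ (a ,_) b∈bs))

module ToleranceProperties
  (S : Lat) (γ : Rel (Carrier S) 0ℓ)
  (γ-refl : ∀ x → γ x x)
  (γ-sym : ∀ x y → γ x y → γ y x)
  (γ-∨ : ∀ a b c d → γ a b → γ c d → γ (Lat._∨_ S a c) (Lat._∨_ S b d))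
  (γ-∧ : ∀ a b c d → γ a b → γ c d → γ (Lat._∧_ S a c) (Lat._∧_ S b d))
  where

  open Lat S hiding (Carrier)

  private
    lattice : Lattice 0ℓ 0ℓ 0ℓ
    lattice = record
      { Carrier = Carrier S ; _≈_ = _≡_ ; _≤_ = _≤_ ; _∨_ = _∨_ ; _∧_ = _∧_
      ; isLattice = isLattice }

  open Lattice lattice using (x≤x∨y; x∧y≤x)
  open JoinSemilatticeProperties (Lattice.joinSemilattice lattice)
    using (∨-comm; ∨-idempotent; x≤y⇒x∨y≈y)
  open MeetSemilatticeProperties (Lattice.meetSemilattice lattice)
    using (∧-comm; ∧-idempotent; y≤x⇒x∧y≈y)

  γ-convexˡ : ∀ {x y z} → x ≤ y → y ≤ z → γ x z → γ x y
  γ-convexˡ {x} {y} {z} x≤y y≤z γxz =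
    subst₂ γ (trans (∧-comm x y) (y≤x⇒x∧y≈y x≤y)) (y≤x⇒x∧y≈y y≤z)
      (γ-∧ x z y y γxz (γ-refl y))

  γ-convexʳ : ∀ {x y z} → x ≤ y → y ≤ z → γ x z → γ y z
  γ-convexʳ {x} {y} {z} x≤y y≤z γxz =
    subst₂ γ (x≤y⇒x∨y≈y x≤y) (trans (∨-comm z y) (x≤y⇒x∨y≈y y≤z))
      (γ-∨ x z y y γxz (γ-refl y))

  γ-via-upper : ∀ {x y z} → x ≤ z → y ≤ z → γ x z → γ y z → γ x y
  γ-via-upper {x} {y} {z} x≤z y≤z γxz γyz =
    subst₂ γ (trans (∧-comm x z) (y≤x⇒x∧y≈y x≤z)) (y≤x⇒x∧y≈y y≤z)
      (γ-∧ x z z y γxz (γ-sym y z γyz))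

  γ-via-lower : ∀ {x y z} → z ≤ x → z ≤ y → γ z x → γ z y → γ x y
  γ-via-lower {x} {y} {z} z≤x z≤y γzx γzy =
    subst₂ γ (trans (∨-comm x z) (x≤y⇒x∨y≈y z≤x)) (x≤y⇒x∨y≈y z≤y)
      (γ-∨ x z z y (γ-sym z x γzx) γzy)

  γ-meet-join : ∀ {x y} → γ x y → γ (x ∧ y) (x ∨ y)
  γ-meet-join {x} {y} γxy =
    subst (λ u → γ u (x ∨ y)) (∨-idempotent (x ∧ y)) (γ-∨ (x ∧ y) x (x ∧ y) y γ∧x γ∧y)
    where
    γ∧x : γ (x ∧ y) x
    γ∧x = subst (γ (x ∧ y)) (∧-idempotent x) (γ-∧ x x y x (γ-refl x) (γ-sym x y γxy))
    γ∧y : γ (x ∧ y) y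
    γ∧y = subst (γ (x ∧ y)) (∧-idempotent y) (γ-∧ x y y y γxy (γ-refl y))

  γ-≤∨ˡ : ∀ {x y} → γ x y → γ x (x ∨ y)
  γ-≤∨ˡ {x} {y} γxy = γ-convexʳ (x∧y≤x x y) (x≤x∨y x y) (γ-meet-join γxy)

  γ-≤∨ʳ : ∀ {x y} → γ x y → γ y (x ∨ y)
  γ-≤∨ʳ {x} {y} γxy = subst (γ y) (∨-comm y x) (γ-≤∨ˡ (γ-sym x y γxy))

module SumProperties (Sys : MCSystem) where

  open MCSystem Sys
  open IsLattice isLattice
    using (x≤x∨y; y≤x∨y; ∨-least; x∧y≤x; x∧y≤y; ∧-greatest)
    renaming (refl to ≤-refl; trans to ≤-trans)
  open ToleranceProperties S γ γ-refl γ-sym γ-∨ γ-∧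
  open ≡-Reasoning

  module _ {x y : Carrier S} (x≤γy : x ≤γ y) where

    F-upward : ∀ {a b} → F x y a → Lat._≤_ (L x) a b → F x y b
    F-upward = proj₁ (proj₁ (MC3 x y x≤γy)) _ _

    I-downward : ∀ {a b} → I x y b → Lat._≤_ (L y) a b → I x y a
    I-downward = proj₁ (proj₁ (proj₂ (proj₂ (MC3 x y x≤γy)))) _ _

    φ-F⇒I : ∀ {a} → F x y a → I x y (φ x y a)
    φ-F⇒I = proj₁ (proj₂ (proj₂ (proj₂ (MC3 x y x≤γy)))) _

    φ-injective : ∀ {a b} → F x y a → F x y b → φ x y a ≡ φ x y b → a ≡ b
    φ-injective = proj₁ (proj₂ (proj₂ (proj₂ (proj₂ (MC3 x y x≤γy))))) _ _

    φ-onto : ∀ {b} → I x y b → ∃[ a ] (F x y a × φ x y a ≡ b)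
    φ-onto = proj₁ (proj₂ (proj₂ (proj₂ (proj₂ (proj₂ (MC3 x y x≤γy)))))) _

  F-refl : ∀ x a → F x x a
  F-refl x = proj₁ (MC4 x)

  module _ {x z y : Carrier S} (x≤z : x ≤S z) (z≤y : z ≤S y) (γxy : γ x y) where

    F-split : ∀ {a} → F x y a → F x z a × I x z (φ x z a) × F z y (φ x z a)
    F-split = Equivalence.to (proj₁ (MC6 x z y x≤z z≤y γxy) _)

    F-glue : ∀ {a} → F x z a × I x z (φ x z a) × F z y (φ x z a) → F x y a
    F-glue = Equivalence.from (proj₁ (MC6 x z y x≤z z≤y γxy) _)

    φ-compose : ∀ {a} → F x y a → φ x y a ≡ φ z y (φ x z a)
    φ-compose = proj₂ (proj₂ (MC6 x z y x≤z z≤y γxy)) _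

  infix 4 _∼[_]_
  _∼[_]_ : M → Carrier S → M → Set
  (x , a) ∼[ T ] (y , b) = x ≤γ T × y ≤γ T × F x T a × F y T b × φ x T a ≡ φ y T b

  ∼[]-sym : ∀ {m n T} → m ∼[ T ] n → n ∼[ T ] m
  ∼[]-sym (x≤γT , y≤γT , Fa , Fb , eq) = y≤γT , x≤γT , Fb , Fa , sym eq

  ∼[]-trans : ∀ {m k n T} → m ∼[ T ] k → k ∼[ T ] n → m ∼[ T ] n
  ∼[]-trans (x≤γT , _ , Fa , _ , eq₁) (_ , y≤γT , _ , Fb , eq₂) =
    x≤γT , y≤γT , Fa , Fb , trans eq₁ eq₂

  ∼[]-φ : ∀ {z w s c} → z ≤S w → w ≤S s → z ≤γ s → F z s c →
          (z , c) ∼[ s ] (w , φ z w c)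
  ∼[]-φ z≤w w≤s z≤γs@(_ , γzs) Fc =
    z≤γs , (w≤s , γ-convexʳ z≤w w≤s γzs) , Fc , proj₂ (proj₂ (F-split z≤w w≤s γzs Fc)) ,
    φ-compose z≤w w≤s γzs Fc

  ∼[]-lower : ∀ {x a y b s T} → x ≤S s → y ≤S s → s ≤S T →
              (x , a) ∼[ T ] (y , b) → (x , a) ∼[ s ] (y , b)
  ∼[]-lower {x} {a} {y} {b} {s} {T} x≤s y≤s s≤T ((_ , γxT) , (_ , γyT) , Fa , Fb , eq) =
    let Fa-s , _ , Fa-sT = F-split x≤s s≤T γxT Fa
        Fb-s , _ , Fb-sT = F-split y≤s s≤T γyT Fb
    in (x≤s , γ-convexˡ x≤s s≤T γxT) , (y≤s , γ-convexˡ y≤s s≤T γyT) , Fa-s , Fb-s ,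
       φ-injective (s≤T , γ-convexʳ x≤s s≤T γxT) Fa-sT Fb-sT (begin
         φ s T (φ x s a)  ≡⟨ φ-compose x≤s s≤T γxT Fa ⟨
         φ x T a          ≡⟨ eq ⟩
         φ y T b          ≡⟨ φ-compose y≤s s≤T γyT Fb ⟩
         φ s T (φ y s b)  ∎)

  -- MC5 is what lets the tolerance γ x s extend to γ x T.
  ∼[]-raise : ∀ {x a w c s T} → s ≤S T → w ≤γ T → F w T c →
              (x , a) ∼[ s ] (w , c) → (x , a) ∼[ T ] (w , c)
  ∼[]-raise {x} {a} {w} {c} {s} {T} s≤T w≤γT@(_ , γwT) Fc-T
            (x≤γs@(x≤s , _) , (w≤s , _) , Fa , _ , eq) =
    (≤-trans x≤s s≤T , γxT) , w≤γT , Fa-T , Fc-T , (begin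
      φ x T a          ≡⟨ φ-compose x≤s s≤T γxT Fa-T ⟩
      φ s T (φ x s a)  ≡⟨ cong (φ s T) eq ⟩
      φ s T (φ w s c)  ≡⟨ φ-compose w≤s s≤T γwT Fc-T ⟨
      φ w T c          ∎)
    where
    φa∈F-sT : F s T (φ x s a)
    φa∈F-sT = subst (F s T) (sym eq) (proj₂ (proj₂ (F-split w≤s s≤T γwT Fc-T)))
    γxT : γ x T
    γxT = MC5 x s T x≤γs (s≤T , γ-convexʳ w≤s s≤T γwT) (φ x s a , φ-F⇒I x≤γs Fa , φa∈F-sT)
    Fa-T : F x T a
    Fa-T = F-glue x≤s s≤T γxT (Fa , φ-F⇒I x≤γs Fa , φa∈F-sT)

  -- Both identifications descend to w = s₁ ∧ s₂ ≥ z, and MC7 lifts the common value to s₁ ∨ s₂.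
  ∼[]-trans-∨ : ∀ {m k n s₁ s₂} → m ∼[ s₁ ] k → k ∼[ s₂ ] n → m ∼[ s₁ ∨S s₂ ] n
  ∼[]-trans-∨ {k = z , c} {s₁ = s₁} {s₂}
              m∼k@(_ , (z≤s₁ , γzs₁) , _ , Fc₁ , _) k∼n@((z≤s₂ , γzs₂) , _ , Fc₂ , _) =
    ∼[]-trans (∼[]-raise (x≤x∨y s₁ s₂) w≤γT Fc'-T (∼[]-trans m∼k k∼w₁))
              (∼[]-sym (∼[]-raise (y≤x∨y s₁ s₂) w≤γT Fc'-T (∼[]-trans (∼[]-sym k∼n) k∼w₂)))
    where
    w : Carrier S
    w = s₁ ∧S s₂
    c' : Carrier (L w)
    c' = φ z w c
    z≤w : z ≤S w
    z≤w = ∧-greatest z≤s₁ z≤s₂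
    k∼w₁ : (z , c) ∼[ s₁ ] (w , c')
    k∼w₁ = ∼[]-φ z≤w (x∧y≤x s₁ s₂) (z≤s₁ , γzs₁) Fc₁
    k∼w₂ : (z , c) ∼[ s₂ ] (w , c')
    k∼w₂ = ∼[]-φ z≤w (x∧y≤y s₁ s₂) (z≤s₂ , γzs₂) Fc₂
    γs₁s₂ : γ s₁ s₂
    γs₁s₂ = γ-via-lower z≤s₁ z≤s₂ γzs₁ γzs₂
    w≤γT : w ≤γ (s₁ ∨S s₂)
    w≤γT = ≤-trans (x∧y≤x s₁ s₂) (x≤x∨y s₁ s₂) , γ-meet-join γs₁s₂
    Fc'-T : F w (s₁ ∨S s₂) c'
    Fc'-T = let _ , _ , _ , Fc'₁ , _ = k∼w₁
                _ , _ , _ , Fc'₂ , _ = k∼w₂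
            in proj₂ (MC7 s₁ s₂ γs₁s₂) c' Fc'₁ Fc'₂

  ∼⇒∼[] : ∀ {x a y b} → (x , a) ∼ (y , b) → (x , a) ∼[ x ∨S y ] (y , b)
  ∼⇒∼[] {x} {y = y} (γxy , Fa , Fb , eq) =
    (x≤x∨y x y , γ-≤∨ˡ γxy) , (y≤x∨y x y , γ-≤∨ʳ γxy) , Fa , Fb , eq

  ∼[]⇒∼ : ∀ {x a y b T} → (x , a) ∼[ T ] (y , b) → (x , a) ∼ (y , b)
  ∼[]⇒∼ {x} {y = y} x∼y@((x≤T , γxT) , (y≤T , γyT) , _) =
    let _ , _ , Fa , Fb , eq = ∼[]-lower (x≤x∨y x y) (y≤x∨y x y) (∨-least x≤T y≤T) x∼y
    in γ-via-upper x≤T y≤T γxT γyT , Fa , Fb , eq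

  ∼-refl : ∀ {m} → m ∼ m
  ∼-refl {x , a} =
    ∼[]⇒∼ {T = x} ((≤-refl , γ-refl x) , (≤-refl , γ-refl x) , F-refl x a , F-refl x a , refl)

  ∼-sym : ∀ {m n} → m ∼ n → n ∼ m
  ∼-sym = ∼[]⇒∼ ∘ ∼[]-sym ∘ ∼⇒∼[]

  ∼-trans : ∀ {m k n} → m ∼ k → k ∼ n → m ∼ n
  ∼-trans m∼k k∼n = ∼[]⇒∼ (∼[]-trans-∨ (∼⇒∼[] m∼k) (∼⇒∼[] k∼n))

  F⇒∼ : ∀ {x y a} → x ≤γ y → F x y a → (x , a) ∼ (y , φ x y a)
  F⇒∼ x≤γy@(x≤y , _) Fa = ∼[]⇒∼ (∼[]-φ x≤y ≤-refl x≤γy Fa)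

  I⇒∼ : ∀ {z s t b} → z ≤γ s → z ≤S t → t ≤S s → I z s b → ∃[ e ] ((t , e) ∼ (s , b))
  I⇒∼ {z} {s} {t} z≤γs@(z≤s , _) z≤t t≤s Ib with φ-onto z≤γs Ib
  ... | c , Fc , refl =
    φ z t c , ∼[]⇒∼ (∼[]-trans (∼[]-sym (∼[]-φ z≤t t≤s z≤γs Fc)) (∼[]-φ z≤s ≤-refl z≤γs Fc))

  ∼⇒I∧ : ∀ {x a y b} → (x , a) ∼ (y , b) → (x ∧S y) ≤γ x × I (x ∧S y) x a
  ∼⇒I∧ {x} {a} {y} {b} (γxy , Fa , Fb , eq) =
    let h , Fh , φh≡φa = φ-onto (≤-trans p≤x x≤u , γpu) φa∈I-pu
        Fh-x , _ , φh∈F-xu = F-split p≤x x≤u γpu Fh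
        φh≡a : φ p x h ≡ a
        φh≡a = φ-injective x≤γu φh∈F-xu Fa (trans (sym (φ-compose p≤x x≤u γpu Fh)) φh≡φa)
    in p≤γx , subst (I p x) φh≡a (φ-F⇒I p≤γx Fh-x)
    where
    p u : Carrier S
    p = x ∧S y
    u = x ∨S y
    p≤x : p ≤S x
    p≤x = x∧y≤x x y
    x≤u : x ≤S u
    x≤u = x≤x∨y x y
    γpu : γ p u
    γpu = γ-meet-join γxy
    x≤γu : x ≤γ u
    x≤γu = x≤u , γ-≤∨ˡ γxy
    p≤γx : p ≤γ x
    p≤γx = p≤x , γ-convexˡ p≤x x≤u γpu
    φa∈I-pu : I p u (φ x u a)
    φa∈I-pu = proj₁ (MC7 x y γxy) _ (φ-F⇒I x≤γu Fa)
                (subst (I y u) (sym eq) (φ-F⇒I (y≤x∨y x y , γ-≤∨ʳ γxy) Fb))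

  HasRepAbove : Carrier S → M → Set
  HasRepAbove x m = ∃[ w ] ∃[ r ] (x ≤S w × (w , r) ∼ m)

  HasRepBelow : Carrier S → M → Set
  HasRepBelow y m = ∃[ u ] ∃[ r ] (u ≤S y × (u , r) ∼ m)

  ≤[]-HasRepAbove : ∀ {x v m k} → m ≤[ v ] k → HasRepAbove x m → HasRepAbove x k
  ≤[]-HasRepAbove {v = v} (p , q , vp∼m , vq∼k , p≤q) (w , r , x≤w , wr∼m) =
    let v≤γT , _ , Fp , _ = ∼⇒∼[] (∼-trans vp∼m (∼-sym wr∼m))
    in v ∨S w , φ v (v ∨S w) q , ≤-trans x≤w (y≤x∨y v w) ,
       ∼-trans (∼-sym (F⇒∼ v≤γT (F-upward v≤γT Fp p≤q))) vq∼k

  ≤[]-HasRepBelow : ∀ {y v m k} → m ≤[ v ] k → HasRepBelow y k → HasRepBelow y m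
  ≤[]-HasRepBelow {v = v} (p , q , vp∼m , vq∼k , p≤q) (u , r , u≤y , ur∼k) =
    let vu≤γv , Iq = ∼⇒I∧ (∼-trans vq∼k (∼-sym ur∼k))
        e , vu-e∼vp = I⇒∼ vu≤γv ≤-refl (proj₁ vu≤γv) (I-downward vu≤γv Iq p≤q)
    in v ∧S u , e , ≤-trans (x∧y≤y v u) u≤y , ∼-trans vu-e∼vp vp∼m

  ChainFrom-HasRepAbove : ∀ {x v m n} → ChainFrom v m n → HasRepAbove x m → HasRepAbove x n
  ChainFrom-HasRepAbove (one m≤n)        = ≤[]-HasRepAbove m≤n
  ChainFrom-HasRepAbove (more _ m≤k k≤n) = ChainFrom-HasRepAbove k≤n ∘ ≤[]-HasRepAbove m≤k

  ChainFrom-HasRepBelow : ∀ {y v m n} → ChainFrom v m n → HasRepBelow y n → HasRepBelow y m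
  ChainFrom-HasRepBelow (one m≤n)        = ≤[]-HasRepBelow m≤n
  ChainFrom-HasRepBelow (more _ m≤k k≤n) = ≤[]-HasRepBelow m≤k ∘ ChainFrom-HasRepBelow k≤n

  ≤L-HasRepAbove : ∀ {x a m} → (x , a) ≤L m → HasRepAbove x m
  ≤L-HasRepAbove {x} {a} (inj₁ xa∼m)       = x , a , ≤-refl , xa∼m
  ≤L-HasRepAbove {x} {a} (inj₂ (_ , chain)) = ChainFrom-HasRepAbove chain (x , a , ≤-refl , ∼-refl)

  ≤L-HasRepBelow : ∀ {y b m} → m ≤L (y , b) → HasRepBelow y m
  ≤L-HasRepBelow {y} {b} (inj₁ m∼yb)       = y , b , ≤-refl , ∼-sym m∼yb
  ≤L-HasRepBelow {y} {b} (inj₂ (_ , chain)) = ChainFrom-HasRepBelow chain (y , b , ≤-refl , ∼-refl)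

  ≤L-interval-rep : ∀ {x a y b m} → (x , a) ≤L m → m ≤L (y , b) →
                    ∃[ t ] ∃[ e ] ((x ∧S y ≤S t × t ≤S y) × m ∼ (t , e))
  ≤L-interval-rep {x} {y = y} a≤m m≤b =
    let w , r , x≤w , wr∼m = ≤L-HasRepAbove a≤m
        u , s , u≤y , us∼m = ≤L-HasRepBelow m≤b
        wu≤γw , Ir = ∼⇒I∧ (∼-trans wr∼m (∼-sym us∼m))
        wu≤w = proj₁ wu≤γw
        t = (w ∧S u) ∨S (x ∧S y)
        e , te∼wr = I⇒∼ {t = t} wu≤γw (x≤x∨y _ _)
                      (∨-least wu≤w (≤-trans (x∧y≤x x y) x≤w)) Ir
    in t , e , (y≤x∨y _ _ , ∨-least (≤-trans (x∧y≤y w u) u≤y) (x∧y≤y x y)) ,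
       ∼-sym (∼-trans te∼wr wr∼m)

theorem4p46 : (Σ : MCSystem) → MCSystem.LocallyFinite Σ
theorem4p46 Sys (x , a) (y , b) = dependentPairs (proj₁ interval) elements , covered
  where
  open MCSystem Sys
  open SumProperties Sys
  interval = proj₁ MC1 (x ∧S y) y
  elements : (t : Carrier S) → List (Carrier (L t))
  elements t = proj₁ (proj₁ (MC2 t))
  covered : ∀ m → (x , a) ≤L m → m ≤L (y , b) →
            Any (m ∼_) (dependentPairs (proj₁ interval) elements)
  covered m a≤m m≤b =
    let t , e , (x∧y≤t , t≤y) , m∼te = ≤L-interval-rep a≤m m≤b
    in lose (∈-dependentPairs (proj₂ interval t x∧y≤t t≤y) (proj₂ (proj₁ (MC2 t)) e)) m∼te
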